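{- Let $A(z)=\sum_{n\geq 0}|\mathcal{A}(n)|\frac{z^n}{n!}$, $B(z)=\sum_{n\geq 0}|\mathcal{A}_{0,*}(n)|\frac{z^n}{n!}$ and $C(z)=\sum_{n\geq 0}|\mathcal{A}_{0,1}(n)|\frac{z^n}{n!}$. Then $$A(z)=\frac{1}{(1-z)^2},\qquad B(z)=\frac{1}{1-z},\qquad C(z)=-\log(1-z).$$
   Context: A shape of length $n$ is a Ferrers diagram in English notation (possibly with empty rows or columns), determined by its south-east border, a path of $n$ unit south/west steps from the top-right to the bottom-left corner; south steps correspond to rows, west steps to columns. An alternative tableau is a shape with a partial filling of cells by left arrows and up arrows such that every cell to the left of a left arrow in its row, and every cell above an up arrow in its column, is empty. Its length is that of its shape. A free row is a row with no left arrow; a free column is a column with no up arrow. $\mathcal{A}(n)$ is the set of alternative tableaux of length $n$ (the empty tableau being the unique one of length $0$). $\mathcal{A}_{i,j}(n)$ is the subset of those with exactly $i$ free rows and $j$ free columns, and a $*$ means no restriction on the corresponding number. -}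

module Defs where

open import Data.Nat using (ℕ; zero; suc; _<_; _+_)
open import Data.Fin using (Fin; toℕ)
open import Data.Bool using (Bool; true; false; _∧_; not)
open import Data.Vec using (Vec; lookup)
open import Data.List using (List; allFin; foldr)
open import Data.Bool.ListAction using (any)
open import Data.Product using (Σ; _×_)
open import Relation.Binary.PropositionalEquality using (_≡_)
open import Relation.Nullary using (¬_)

-- A shape of length n: its south-east border path, read from the top-right
-- corner to the bottom-left corner.  Entry p is `true` for a south step
-- (a row) and `false` for a west step (a column).
Shape : ℕ → Set
Shape n = Vec Bool n

isRow : ∀ {n} → Shape n → Fin n → Bool
isRow s p = lookup s p

isCol : ∀ {n} → Shape n → Fin n → Bool
isCol s q = not (lookup s q)

-- The row given by the south step at position p and the column given by the
-- west step at position q meet in a cell of the Ferrers diagram iff p < q.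
-- Rows are thus ordered top-to-bottom by p, columns right-to-left by q:
-- "to the left of (p,q)" means (p,q') with q < q', "above (p,q)" means
-- (p',q) with p' < p.
IsCell : ∀ {n} → Shape n → Fin n → Fin n → Set
IsCell s p q = (isRow s p ≡ true) × (isCol s q ≡ true) × (toℕ p < toℕ q)

data Content : Set where
  empty : Content
  left  : Content
  up    : Content

-- A (partial) filling: an n×n array indexed by step positions; only entries
-- at cells of the shape may be non-empty.
Filling : ℕ → Set
Filling n = Vec (Vec Content n) n

entry : ∀ {n} → Filling n → Fin n → Fin n → Content
entry f p q = lookup (lookup f p) q

record ValidFilling {n} (s : Shape n) (f : Filling n) : Set where
  field
    onCells   : ∀ p q → ¬ IsCell s p q → entry f p q ≡ empty
    leftRule  : ∀ p q q' → entry f p q ≡ left → toℕ q < toℕ q' → entry f p q' ≡ empty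
    upRule    : ∀ p p' q → entry f p q ≡ up → toℕ p' < toℕ p → entry f p' q ≡ empty

-- Alternative tableaux of length n, the set 𝒜(n).  The validity proof is
-- irrelevant, so two tableaux are equal iff shape and filling are equal.
record AltTableau (n : ℕ) : Set where
  constructor mkAT
  field
    shape  : Shape n
    fill   : Filling n
    .valid : ValidFilling shape fill
open AltTableau public

isLeft : Content → Bool
isLeft left = true
isLeft _    = false

isUp : Content → Bool
isUp up = true
isUp _  = false

countᵇ : ∀ {n} → (Fin n → Bool) → ℕ
countᵇ {n} P = foldr (λ i acc → (if P i then 1 else 0) + acc) 0 (allFin n)
  where open import Data.Bool using (if_then_else_)

freeRow : ∀ {n} → AltTableau n → Fin n → Bool
freeRow {n} t p = isRow (shape t) p ∧ not (any (λ q → isLeft (entry (fill t) p q)) (allFin n))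

freeCol : ∀ {n} → AltTableau n → Fin n → Bool
freeCol {n} t q = isCol (shape t) q ∧ not (any (λ p → isUp (entry (fill t) p q)) (allFin n))

freeRows : ∀ {n} → AltTableau n → ℕ
freeRows t = countᵇ (freeRow t)

freeCols : ∀ {n} → AltTableau n → ℕ
freeCols t = countᵇ (freeCol t)

A0* : ℕ → Set
A0* n = Σ (AltTableau n) (λ t → freeRows t ≡ 0)

A01 : ℕ → Set
A01 n = Σ (AltTableau n) (λ t → (freeRows t ≡ 0) × (freeCols t ≡ 1))

-- EGF coefficient data: the n-th coefficient of Σ a_n zⁿ/n! times n!.
-- 1/(1-z)² = Σ (n+1) zⁿ  ⇒ a_n = (n+1)!;  1/(1-z) ⇒ a_n = n!;
-- -log(1-z) = Σ_{n≥1} zⁿ/n ⇒ a_0 = 0, a_{n} = (n-1)! for n ≥ 1.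

{-# OPTIONS --safe #-}
-- Consider the tableaux of length n + 1 whose numbers of free rows
-- and columns satisfy a predicate P, and look at the last step of the border.
-- A last south step is a row without cells; deleting it gives a tableau of
-- length n with one free row fewer.  A last west step is moved to the front
-- one position at a time.  Whenever it passes a south step the two steps
-- meet in a corner cell, which is either empty (then the two steps can be
-- exchanged), or holds an up arrow (then its column is forced, and is
-- deleted), or holds a left arrow (then its row is forced, and is deleted);
-- none of these changes the numbers of free rows and columns.  Having reached
-- the front, it is a column without cells, deleted with one free column less.
-- The deletions made on the way add up to n copies of all tableaux of
-- length n, so with a_P(n) the number of such tableaux,
--   a_P(n + 1) = a_{P(r+1,c)}(n) + a_{P(r,c+1)}(n) + n · a_P(n).
-- This gives (n + 2)! = 2 (n + 1)! + n (n + 1)! for all tableaux and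
-- (n + 1)! = n! + n · n! for those without free rows; with one free column
-- and no free row, the middle term only survives for n = 0, because every
-- nonempty tableau has a free row or a free column.
module Submission where

open import Defs
open import Algebra.Bundles using (CommutativeMonoid)
import Algebra.Properties.CommutativeSemigroup as CommutativeSemigroupProperties
open import Data.Bool using (Bool; true; false; _∧_; _∨_; not; if_then_else_)
open import Data.Bool.ListAction using (any)
import Data.Bool.Properties as Boolₚ
open import Data.Empty using (⊥; ⊥-elim)
open import Data.Fin using (Fin; zero; suc; toℕ; punchIn; inject₁; fromℕ; _<_)
import Data.Fin as Fin
import Data.Fin.Properties as Finₚ
import Data.List as List
open import Data.Nat using (ℕ; zero; suc; _+_; _*_; _!)
import Data.Nat as ℕ
import Data.Nat.Properties as ℕₚ
open import Data.Product using (Σ; _×_; _,_; proj₁; proj₂)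
open import Data.Product.Algebra using (×-cong; Σ-assoc; ×-identityʳ)
open import Data.Product.Function.Dependent.Propositional using (Σ-↔)
open import Data.Sum using (_⊎_; inj₁; inj₂; [_,_])
open import Data.Sum.Algebra using (⊎-cong)
open import Data.Unit.Polymorphic using (⊤)
open import Data.Vec using (Vec; []; _∷_; lookup; tabulate; removeAt; _∷ʳ_)
import Data.Vec.Properties as Vecₚ
open import Function using (_∘_)
open import Function.Bundles using (_↔_; Inverse; mk↔ₛ′)
open import Function.Properties.Inverse using (↔-refl; ↔-sym; ↔-trans)
open import Function.Related.Propositional using (module EquationalReasoning)
open import Function.Related.TypeIsomorphisms using (Σ-distribˡ-⊎; Σ-distribʳ-⊎; ×-distribˡ-⊎)
open import Relation.Binary.PropositionalEquality hiding ([_])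
open import Relation.Nullary using (¬_; Dec; yes; no)
open import Relation.Nullary.Decidable using (_×-dec_; recompute; toSum)

private
  variable
    m n : ℕ

module +-Props = CommutativeSemigroupProperties ℕₚ.+-commutativeSemigroup
module ∨-Props = CommutativeSemigroupProperties
  (CommutativeMonoid.commutativeSemigroup Boolₚ.∨-commutativeMonoid)

bit : Bool → ℕ
bit b = if b then 1 else 0

count : (Fin n → Bool) → ℕ
count {zero}  P = 0
count {suc n} P = bit (P zero) + count (P ∘ suc)

anyFin : (Fin n → Bool) → Bool
anyFin {zero}  P = false
anyFin {suc n} P = P zero ∨ anyFin (P ∘ suc)

count-tabulate : (P : Fin m → Bool) (f : Fin n → Fin m) →
  List.foldr (λ i acc → bit (P i) + acc) 0 (List.tabulate f) ≡ count (P ∘ f)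
count-tabulate {n = zero}  P f = refl
count-tabulate {n = suc n} P f = cong (bit (P (f zero)) +_) (count-tabulate P (f ∘ suc))

any-tabulate : (P : Fin m → Bool) (f : Fin n → Fin m) →
  any P (List.tabulate f) ≡ anyFin (P ∘ f)
any-tabulate {n = zero}  P f = refl
any-tabulate {n = suc n} P f = cong (P (f zero) ∨_) (any-tabulate P (f ∘ suc))

countᵇ≡count : (P : Fin n → Bool) → countᵇ P ≡ count P
countᵇ≡count P = count-tabulate P (λ i → i)

any-allFin≡anyFin : (P : Fin n → Bool) → any P (List.allFin n) ≡ anyFin P
any-allFin≡anyFin P = any-tabulate P (λ i → i)

count-cong : {P Q : Fin n → Bool} → P ≗ Q → count P ≡ count Q
count-cong {zero}  eq = refl
count-cong {suc n} eq = cong₂ (λ b c → bit b + c) (eq zero) (count-cong (eq ∘ suc))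

anyFin-cong : {P Q : Fin n → Bool} → P ≗ Q → anyFin P ≡ anyFin Q
anyFin-cong {zero}  eq = refl
anyFin-cong {suc n} eq = cong₂ _∨_ (eq zero) (anyFin-cong (eq ∘ suc))

count-punchIn : (P : Fin (suc n) → Bool) (j : Fin (suc n)) →
  count P ≡ bit (P j) + count (P ∘ punchIn j)
count-punchIn P zero = refl
count-punchIn {suc n} P (suc j) =
  trans (cong (bit (P zero) +_) (count-punchIn (P ∘ suc) j))
        (+-Props.x∙yz≈y∙xz (bit (P zero)) (bit (P (suc j))) _)

anyFin-punchIn : (P : Fin (suc n) → Bool) (j : Fin (suc n)) →
  anyFin P ≡ P j ∨ anyFin (P ∘ punchIn j)
anyFin-punchIn P zero = refl
anyFin-punchIn {suc n} P (suc j) =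
  trans (cong (P zero ∨_) (anyFin-punchIn (P ∘ suc) j))
        (∨-Props.x∙yz≈y∙xz (P zero) (P (suc j)) _)

anyFin-false : (P : Fin n → Bool) → (∀ x → P x ≡ false) → anyFin P ≡ false
anyFin-false {zero}  P none = refl
anyFin-false {suc n} P none rewrite none zero = anyFin-false (P ∘ suc) (none ∘ suc)

anyFin-true : (P : Fin (suc n) → Bool) (j : Fin (suc n)) → P j ≡ true → anyFin P ≡ true
anyFin-true P j Pj rewrite anyFin-punchIn P j | Pj = refl

punchIn-mono-< : ∀ (j : Fin (suc n)) {x y} → x < y → punchIn j x < punchIn j y
punchIn-mono-< zero                    x<y         = ℕ.s≤s x<y
punchIn-mono-< (suc j) {zero}  {suc y} _           = ℕ.s≤s ℕ.z≤n
punchIn-mono-< (suc j) {suc x} {suc y} (ℕ.s≤s x<y) = ℕ.s≤s (punchIn-mono-< j x<y)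

punchIn-cancel-< : ∀ (j : Fin (suc n)) {x y} → punchIn j x < punchIn j y → x < y
punchIn-cancel-< zero                    (ℕ.s≤s x<y) = x<y
punchIn-cancel-< (suc j) {zero}  {suc y} _           = ℕ.s≤s ℕ.z≤n
punchIn-cancel-< (suc j) {suc x} {suc y} (ℕ.s≤s x<y) = ℕ.s≤s (punchIn-cancel-< j x<y)

data PunchInView (j : Fin (suc n)) : Fin (suc n) → Set where
  here    : PunchInView j j
  punched : (x : Fin n) → PunchInView j (punchIn j x)

punchInView : (j p : Fin (suc n)) → PunchInView j p
punchInView zero    zero    = here
punchInView zero    (suc x) = punched x
punchInView {suc n} (suc j) zero = punched zero
punchInView {suc n} (suc j) (suc p) with punchInView j p
... | here      = here
... | punched x = punched (suc x)

punchInView-here : (j : Fin (suc n)) → punchInView j j ≡ here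
punchInView-here zero = refl
punchInView-here {suc n} (suc j) rewrite punchInView-here j = refl

punchInView-punchIn : (j : Fin (suc n)) (x : Fin n) → punchInView j (punchIn j x) ≡ punched x
punchInView-punchIn zero x = refl
punchInView-punchIn {suc n} (suc j) zero = refl
punchInView-punchIn {suc n} (suc j) (suc x) rewrite punchInView-punchIn j x = refl

swapAt : Fin (suc n) → Fin (suc (suc n)) → Fin (suc (suc n))
swapAt zero    zero          = suc zero
swapAt zero    (suc zero)    = zero
swapAt zero    (suc (suc x)) = suc (suc x)
swapAt {suc n} (suc k) zero    = zero
swapAt {suc n} (suc k) (suc x) = suc (swapAt k x)

swapAt-involutive : ∀ (k : Fin (suc n)) p → swapAt k (swapAt k p) ≡ p
swapAt-involutive zero zero          = refl
swapAt-involutive zero (suc zero)    = refl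
swapAt-involutive zero (suc (suc p)) = refl
swapAt-involutive {suc n} (suc k) zero    = refl
swapAt-involutive {suc n} (suc k) (suc p) = cong suc (swapAt-involutive k p)

swapAt-inject₁ : (k : Fin (suc n)) → swapAt k (inject₁ k) ≡ suc k
swapAt-inject₁ zero = refl
swapAt-inject₁ {suc n} (suc k) = cong suc (swapAt-inject₁ k)

swapAt-suc : (k : Fin (suc n)) → swapAt k (suc k) ≡ inject₁ k
swapAt-suc zero = refl
swapAt-suc {suc n} (suc k) = cong suc (swapAt-suc k)

swapAt-punchIn : ∀ (k : Fin (suc n)) x → swapAt k (punchIn (inject₁ k) x) ≡ punchIn (suc k) x
swapAt-punchIn zero zero    = refl
swapAt-punchIn zero (suc x) = refl
swapAt-punchIn {suc n} (suc k) zero    = refl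
swapAt-punchIn {suc n} (suc k) (suc x) = cong suc (swapAt-punchIn k x)

swapAt-mono-< : ∀ (k : Fin (suc n)) {p q} → p < q →
  swapAt k p < swapAt k q ⊎ (p ≡ inject₁ k × q ≡ suc k)
swapAt-mono-< zero {zero}        {suc zero}    _ = inj₂ (refl , refl)
swapAt-mono-< zero {zero}        {suc (suc q)} _ = inj₁ (ℕ.s≤s (ℕ.s≤s ℕ.z≤n))
swapAt-mono-< zero {suc zero}    {suc (suc q)} _ = inj₁ (ℕ.s≤s ℕ.z≤n)
swapAt-mono-< zero {suc (suc p)} {suc (suc q)} p<q = inj₁ p<q
swapAt-mono-< zero {suc zero}    {suc zero}    (ℕ.s≤s ())
swapAt-mono-< zero {suc (suc p)} {suc zero}    (ℕ.s≤s ())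
swapAt-mono-< {suc n} (suc k) {zero}  {suc q} _ = inj₁ (ℕ.s≤s ℕ.z≤n)
swapAt-mono-< {suc n} (suc k) {suc p} {suc q} (ℕ.s≤s p<q) with swapAt-mono-< k p<q
... | inj₁ p′<q′          = inj₁ (ℕ.s≤s p′<q′)
... | inj₂ (p≡k , q≡k+1) = inj₂ (cong suc p≡k , cong suc q≡k+1)

count-swapAt : (k : Fin (suc n)) (P : Fin (suc (suc n)) → Bool) → count (P ∘ swapAt k) ≡ count P
count-swapAt k P = begin
  count (P ∘ swapAt k)
    ≡⟨ count-punchIn (P ∘ swapAt k) (inject₁ k) ⟩
  bit (P (swapAt k (inject₁ k))) + count (P ∘ swapAt k ∘ punchIn (inject₁ k))
    ≡⟨ cong₂ (λ b c → bit b + c) (cong P (swapAt-inject₁ k)) (count-cong (cong P ∘ swapAt-punchIn k)) ⟩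
  bit (P (suc k)) + count (P ∘ punchIn (suc k))
    ≡⟨ count-punchIn P (suc k) ⟨
  count P ∎
  where open ≡-Reasoning

anyFin-swapAt : (k : Fin (suc n)) (P : Fin (suc (suc n)) → Bool) → anyFin (P ∘ swapAt k) ≡ anyFin P
anyFin-swapAt k P = begin
  anyFin (P ∘ swapAt k)
    ≡⟨ anyFin-punchIn (P ∘ swapAt k) (inject₁ k) ⟩
  P (swapAt k (inject₁ k)) ∨ anyFin (P ∘ swapAt k ∘ punchIn (inject₁ k))
    ≡⟨ cong₂ _∨_ (cong P (swapAt-inject₁ k)) (anyFin-cong (cong P ∘ swapAt-punchIn k)) ⟩
  P (suc k) ∨ anyFin (P ∘ punchIn (suc k))
    ≡⟨ anyFin-punchIn P (suc k) ⟨
  anyFin P ∎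
  where open ≡-Reasoning

inject₁<suc : (k : Fin (suc n)) → inject₁ k < suc k
inject₁<suc zero = ℕ.s≤s ℕ.z≤n
inject₁<suc {suc n} (suc k) = ℕ.s≤s (inject₁<suc k)

inject₁<⇒≮suc : ∀ (k : Fin (suc n)) (x : Fin (suc (suc n))) → inject₁ k < x → x < suc k → ⊥
inject₁<⇒≮suc zero    (suc x) _ (ℕ.s≤s ())
inject₁<⇒≮suc {suc n} (suc k) (suc x) (ℕ.s≤s k<x) (ℕ.s≤s x<k+1) = inject₁<⇒≮suc k x k<x x<k+1

inject₁<∧≢suc⇒suc< : ∀ (k : Fin (suc n)) (q : Fin (suc (suc n))) → inject₁ k < q → q ≢ suc k → suc k < q
inject₁<∧≢suc⇒suc< zero (suc zero)    _ q≢1 = ⊥-elim (q≢1 refl)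
inject₁<∧≢suc⇒suc< zero (suc (suc q)) _ _   = ℕ.s≤s (ℕ.s≤s ℕ.z≤n)
inject₁<∧≢suc⇒suc< {suc n} (suc k) (suc q) (ℕ.s≤s k<q) q≢k+1 =
  ℕ.s≤s (inject₁<∧≢suc⇒suc< k q k<q (q≢k+1 ∘ cong suc))

<suc∧≢inject₁⇒<inject₁ : ∀ (k : Fin (suc n)) (p : Fin (suc (suc n))) → p < suc k → p ≢ inject₁ k → p < inject₁ k
<suc∧≢inject₁⇒<inject₁ zero    zero    _ p≢0 = ⊥-elim (p≢0 refl)
<suc∧≢inject₁⇒<inject₁ zero    (suc p) (ℕ.s≤s ())
<suc∧≢inject₁⇒<inject₁ {suc n} (suc k) zero    _ _ = ℕ.s≤s ℕ.z≤n
<suc∧≢inject₁⇒<inject₁ {suc n} (suc k) (suc p) (ℕ.s≤s p<k+1) p≢k =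
  ℕ.s≤s (<suc∧≢inject₁⇒<inject₁ k p p<k+1 (p≢k ∘ cong suc))

lookup-ext : ∀ {A : Set} {u v : Vec A n} → (∀ i → lookup u i ≡ lookup v i) → u ≡ v
lookup-ext {u = u} {v} eq =
  trans (sym (Vecₚ.tabulate∘lookup u)) (trans (Vecₚ.tabulate-cong eq) (Vecₚ.tabulate∘lookup v))

lookup-removeAt : ∀ {A : Set} (s : Vec A (suc n)) j x → lookup (removeAt s j) x ≡ lookup s (punchIn j x)
lookup-removeAt s j x =
  trans (cong (lookup (removeAt s j)) (sym (Finₚ.punchOut-punchIn j))) (Vecₚ.removeAt-punchOut s _)

removeAt-∷ʳ : ∀ {A : Set} (s : Vec A n) b → removeAt (s ∷ʳ b) (fromℕ n) ≡ s
removeAt-∷ʳ []           b = refl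
removeAt-∷ʳ (a ∷ [])     b = refl
removeAt-∷ʳ (a ∷ a′ ∷ s) b = cong (a ∷_) (removeAt-∷ʳ (a′ ∷ s) b)

lookup-∷ʳ-last : ∀ {A : Set} (s : Vec A n) b → lookup (s ∷ʳ b) (fromℕ n) ≡ b
lookup-∷ʳ-last []      b = refl
lookup-∷ʳ-last (a ∷ s) b = lookup-∷ʳ-last s b

swapAdjacent : ∀ {A : Set} → Vec A (suc (suc n)) → Fin (suc n) → Vec A (suc (suc n))
swapAdjacent (a ∷ b ∷ s) zero = b ∷ a ∷ s
swapAdjacent {suc n} (a ∷ b ∷ c ∷ s) (suc k) = a ∷ swapAdjacent (b ∷ c ∷ s) k

lookup-swapAdjacent : ∀ {A : Set} (s : Vec A (suc (suc n))) k p →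
  lookup (swapAdjacent s k) p ≡ lookup s (swapAt k p)
lookup-swapAdjacent (a ∷ b ∷ s) zero zero          = refl
lookup-swapAdjacent (a ∷ b ∷ s) zero (suc zero)    = refl
lookup-swapAdjacent (a ∷ b ∷ s) zero (suc (suc p)) = refl
lookup-swapAdjacent {suc n} (a ∷ b ∷ c ∷ s) (suc k) zero    = refl
lookup-swapAdjacent {suc n} (a ∷ b ∷ c ∷ s) (suc k) (suc p) = lookup-swapAdjacent (b ∷ c ∷ s) k p

tabulateFilling : (Fin n → Fin n → Content) → Filling n
tabulateFilling F = tabulate (tabulate ∘ F)

entry-tabulateFilling : ∀ (F : Fin n → Fin n → Content) p q → entry (tabulateFilling F) p q ≡ F p q
entry-tabulateFilling F p q
  rewrite Vecₚ.lookup∘tabulate (tabulate ∘ F) p = Vecₚ.lookup∘tabulate (F p) q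

filling-ext : {f g : Filling n} → (∀ p q → entry f p q ≡ entry g p q) → f ≡ g
filling-ext eq = lookup-ext (lookup-ext ∘ eq)

_≟ᶜ_ : (a b : Content) → Dec (a ≡ b)
empty ≟ᶜ empty = yes refl
empty ≟ᶜ left  = no λ ()
empty ≟ᶜ up    = no λ ()
left  ≟ᶜ empty = no λ ()
left  ≟ᶜ left  = yes refl
left  ≟ᶜ up    = no λ ()
up    ≟ᶜ empty = no λ ()
up    ≟ᶜ left  = no λ ()
up    ≟ᶜ up    = yes refl

left≢empty : left ≢ empty
left≢empty ()

up≢empty : up ≢ empty
up≢empty ()

left≢up : left ≢ up
left≢up ()

isCell? : (s : Shape n) → ∀ p q → Dec (IsCell s p q)
isCell? s p q = (isRow s p Boolₚ.≟ true) ×-dec ((isCol s q Boolₚ.≟ true) ×-dec (toℕ p ℕ.<? toℕ q))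

nonEmpty⇒isCell : {s : Shape n} {f : Filling n} → ValidFilling s f →
  ∀ p q → entry f p q ≢ empty → IsCell s p q
nonEmpty⇒isCell {s = s} v p q ≢empty with isCell? s p q
... | yes cell = cell
... | no ¬cell = ⊥-elim (≢empty (ValidFilling.onCells v p q ¬cell))

false≢true : false ≢ true
false≢true ()

row⇒¬isCell : {s : Shape n} {q : Fin n} → lookup s q ≡ true → ∀ p → ¬ IsCell s p q
row⇒¬isCell row p (_ , col , _) = false≢true (trans (cong not (sym row)) col)

col⇒¬isCell : {s : Shape n} {p : Fin n} → lookup s p ≡ false → ∀ q → ¬ IsCell s p q
col⇒¬isCell col q (row , _) = false≢true (trans (sym col) row)

record Tableau (s : Shape n) : Set where
  constructor tableau
  field
    filling : Filling n
    .valid  : ValidFilling s filling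

tableau-≡ : {s : Shape n} {f g : Filling n} .{v : ValidFilling s f} .{w : ValidFilling s g} →
  f ≡ g → tableau {s = s} f v ≡ tableau g w
tableau-≡ refl = refl

rowFree : Shape n → Filling n → Fin n → Bool
rowFree s f p = isRow s p ∧ not (anyFin λ q → isLeft (entry f p q))

colFree : Shape n → Filling n → Fin n → Bool
colFree s f q = isCol s q ∧ not (anyFin λ p → isUp (entry f p q))

freeCounts : Shape n → Filling n → ℕ × ℕ
freeCounts s f = count (rowFree s f) , count (colFree s f)

stats : {s : Shape n} → Tableau s → ℕ × ℕ
stats {s = s} (tableau f _) = freeCounts s f

freeRows,freeCols≡freeCounts : (t : AltTableau n) → (freeRows t , freeCols t) ≡ freeCounts (shape t) (fill t)
freeRows,freeCols≡freeCounts t = cong₂ _,_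
  (trans (countᵇ≡count (freeRow t)) (count-cong λ p →
    cong (λ b → isRow (shape t) p ∧ not b) (any-allFin≡anyFin (λ q → isLeft (entry (fill t) p q)))))
  (trans (countᵇ≡count (freeCol t)) (count-cong λ q →
    cong (λ b → isCol (shape t) q ∧ not b) (any-allFin≡anyFin (λ p → isUp (entry (fill t) p q)))))

-- Deleting and inserting a line

module Deletion {n} (s : Shape (suc n)) (j : Fin (suc n)) where

  open ValidFilling

  s⁻ : Shape n
  s⁻ = removeAt s j

  π : Fin n → Fin (suc n)
  π = punchIn j

  isCell-punchIn : ∀ {x y} → IsCell s⁻ x y → IsCell s (π x) (π y)
  isCell-punchIn {x} {y} (row , col , x<y) =
    trans (sym (lookup-removeAt s j x)) row ,
    trans (cong not (sym (lookup-removeAt s j y))) col ,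
    punchIn-mono-< j x<y

  isCell-punchIn⁻ : ∀ {x y} → IsCell s (π x) (π y) → IsCell s⁻ x y
  isCell-punchIn⁻ {x} {y} (row , col , x<y) =
    trans (lookup-removeAt s j x) row ,
    trans (cong not (lookup-removeAt s j y)) col ,
    punchIn-cancel-< j x<y

  delete : Filling (suc n) → Filling n
  delete f = tabulateFilling λ x y → entry f (π x) (π y)

  entry-delete : ∀ f x y → entry (delete f) x y ≡ entry f (π x) (π y)
  entry-delete f = entry-tabulateFilling _

  delete-valid : ∀ {f} → ValidFilling s f → ValidFilling s⁻ (delete f)
  delete-valid {f} v = record
    { onCells  = λ x y ¬cell →
        trans (entry-delete f x y) (onCells v _ _ (¬cell ∘ isCell-punchIn⁻))
    ; leftRule = λ x y y′ e y<y′ → trans (entry-delete f x y′)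
        (leftRule v _ _ _ (trans (sym (entry-delete f x y)) e) (punchIn-mono-< j y<y′))
    ; upRule   = λ x x′ y e x′<x → trans (entry-delete f x′ y)
        (upRule v _ _ _ (trans (sym (entry-delete f x y)) e) (punchIn-mono-< j x′<x))
    }

  count-rowFree-delete : ∀ f → (∀ p → isLeft (entry f p j) ≡ false) →
    count (rowFree s f) ≡ bit (rowFree s f j) + count (rowFree s⁻ (delete f))
  count-rowFree-delete f noLeft =
    trans (count-punchIn (rowFree s f) j) (cong (bit (rowFree s f j) +_) (count-cong rowFree-π))
    where
    rowFree-π : ∀ x → rowFree s f (π x) ≡ rowFree s⁻ (delete f) x
    rowFree-π x = cong₂ (λ a b → a ∧ not b) (sym (lookup-removeAt s j x)) (begin
      anyFin (λ q → isLeft (entry f (π x) q))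
        ≡⟨ anyFin-punchIn (λ q → isLeft (entry f (π x) q)) j ⟩
      isLeft (entry f (π x) j) ∨ anyFin (λ y → isLeft (entry f (π x) (π y)))
        ≡⟨ cong (_∨ anyFin (λ y → isLeft (entry f (π x) (π y)))) (noLeft (π x)) ⟩
      anyFin (λ y → isLeft (entry f (π x) (π y)))
        ≡⟨ anyFin-cong (λ y → cong isLeft (sym (entry-delete f x y))) ⟩
      anyFin (λ y → isLeft (entry (delete f) x y)) ∎)
      where open ≡-Reasoning

  count-colFree-delete : ∀ f → (∀ q → isUp (entry f j q) ≡ false) →
    count (colFree s f) ≡ bit (colFree s f j) + count (colFree s⁻ (delete f))
  count-colFree-delete f noUp =
    trans (count-punchIn (colFree s f) j) (cong (bit (colFree s f j) +_) (count-cong colFree-π))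
    where
    colFree-π : ∀ y → colFree s f (π y) ≡ colFree s⁻ (delete f) y
    colFree-π y = cong₂ (λ a b → not a ∧ not b) (sym (lookup-removeAt s j y)) (begin
      anyFin (λ p → isUp (entry f p (π y)))
        ≡⟨ anyFin-punchIn (λ p → isUp (entry f p (π y))) j ⟩
      isUp (entry f j (π y)) ∨ anyFin (λ x → isUp (entry f (π x) (π y)))
        ≡⟨ cong (_∨ anyFin (λ x → isUp (entry f (π x) (π y)))) (noUp (π y)) ⟩
      anyFin (λ x → isUp (entry f (π x) (π y)))
        ≡⟨ anyFin-cong (λ x → cong isUp (sym (entry-delete f x y))) ⟩
      anyFin (λ x → isUp (entry (delete f) x y)) ∎)
      where open ≡-Reasoning

  -- The inserted line j is read both as a row (entries E j q) and as a column
  -- (entries E p j); the entries of E off that line are ignored.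
  module Insertion (E : Fin (suc n) → Fin (suc n) → Content) where

    insertEntry : Filling n → ∀ {p q} → PunchInView j p → PunchInView j q → Content
    insertEntry f {p} {q} here        _           = E p q
    insertEntry f {p} {q} (punched x) here        = E p q
    insertEntry f         (punched x) (punched y) = entry f x y

    insert : Filling n → Filling (suc n)
    insert f = tabulateFilling λ p q → insertEntry f (punchInView j p) (punchInView j q)

    entry-insert : ∀ f p q → entry (insert f) p q ≡ insertEntry f (punchInView j p) (punchInView j q)
    entry-insert f = entry-tabulateFilling _

    entry-insert-π : ∀ f x y → entry (insert f) (π x) (π y) ≡ entry f x y
    entry-insert-π f x y
      rewrite entry-insert f (π x) (π y) | punchInView-punchIn j x | punchInView-punchIn j y = refl

    entry-insert-row : ∀ f q → entry (insert f) j q ≡ E j q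
    entry-insert-row f q rewrite entry-insert f j q | punchInView-here j = refl

    entry-insert-col : ∀ f p → entry (insert f) p j ≡ E p j
    entry-insert-col f p rewrite entry-insert f p j with punchInView j p
    ... | here      = refl
    ... | punched x rewrite punchInView-here j = refl

    delete-insert : ∀ f → delete (insert f) ≡ f
    delete-insert f = filling-ext λ x y → trans (entry-delete (insert f) x y) (entry-insert-π f x y)

    AgreesOnLine : Filling (suc n) → Set
    AgreesOnLine f = ∀ p q → p ≡ j ⊎ q ≡ j → entry f p q ≡ E p q

    insert-delete : ∀ f → AgreesOnLine f → insert (delete f) ≡ f
    insert-delete f agrees = filling-ext λ p q →
      trans (entry-insert (delete f) p q) (insertEntry-delete (punchInView j p) (punchInView j q))
      where
      insertEntry-delete : ∀ {p q} (vp : PunchInView j p) (vq : PunchInView j q) →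
        insertEntry (delete f) vp vq ≡ entry f p q
      insertEntry-delete {q = q} here        _           = sym (agrees j q (inj₁ refl))
      insertEntry-delete {p = p} (punched x) here        = sym (agrees p j (inj₂ refl))
      insertEntry-delete         (punched x) (punched y) = entry-delete f x y

    record Admissible : Set where
      field
        rowOnCells      : ∀ q → ¬ IsCell s j q → E j q ≡ empty
        colOnCells      : ∀ p → ¬ IsCell s p j → E p j ≡ empty
        rowLeftRule     : ∀ q q′ → E j q ≡ left → q < q′ → E j q′ ≡ empty
        colUpRule       : ∀ p p′ → E p j ≡ up → p′ < p → E p′ j ≡ empty
        colNoLeft       : ∀ x → E (π x) j ≢ left
        rowNoUp         : ∀ y → E j (π y) ≢ up
        emptyLeftOfLeft : ∀ f → ValidFilling s⁻ f → ∀ x y →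
          entry f x y ≡ left → π y < j → E (π x) j ≡ empty
        emptyAboveUp    : ∀ f → ValidFilling s⁻ f → ∀ x y →
          entry f x y ≡ up → j < π x → E j (π y) ≡ empty

    insert-valid : Admissible → ∀ {f} → ValidFilling s⁻ f → ValidFilling s (insert f)
    insert-valid adm {f} v = record { onCells = onCells′ ; leftRule = leftRule′ ; upRule = upRule′ }
      where
      open Admissible adm
      row = entry-insert-row f
      col = entry-insert-col f
      old = entry-insert-π f

      onCells′ : ∀ p q → ¬ IsCell s p q → entry (insert f) p q ≡ empty
      onCells′ p q ¬cell with punchInView j p | punchInView j q
      ... | here      | _         = trans (row q) (rowOnCells q ¬cell)
      ... | punched x | here      = trans (col (π x)) (colOnCells (π x) ¬cell)
      ... | punched x | punched y = trans (old x y) (onCells v x y (¬cell ∘ isCell-punchIn))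

      leftRule′ : ∀ p q q′ → entry (insert f) p q ≡ left → q < q′ → entry (insert f) p q′ ≡ empty
      leftRule′ p q q′ e q<q′ with punchInView j p | punchInView j q | punchInView j q′
      ... | here      | _         | _          = trans (row q′) (rowLeftRule q q′ (trans (sym (row q)) e) q<q′)
      ... | punched x | here      | _          = ⊥-elim (colNoLeft x (trans (sym (col (π x))) e))
      ... | punched x | punched y | here       =
        trans (col (π x)) (emptyLeftOfLeft f v x y (trans (sym (old x y)) e) q<q′)
      ... | punched x | punched y | punched y′ =
        trans (old x y′) (leftRule v x y y′ (trans (sym (old x y)) e) (punchIn-cancel-< j q<q′))

      upRule′ : ∀ p p′ q → entry (insert f) p q ≡ up → p′ < p → entry (insert f) p′ q ≡ empty
      upRule′ p p′ q e p′<p with punchInView j q | punchInView j p | punchInView j p′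
      ... | here      | _         | _          = trans (col p′) (colUpRule p p′ (trans (sym (col p)) e) p′<p)
      ... | punched y | here      | _          = ⊥-elim (rowNoUp y (trans (sym (row (π y))) e))
      ... | punched y | punched x | here       =
        trans (row (π y)) (emptyAboveUp f v x y (trans (sym (old x y)) e) p′<p)
      ... | punched y | punched x | punched x′ =
        trans (old x′ y) (upRule v x x′ y (trans (sym (old x y)) e) (punchIn-cancel-< j p′<p))

Σ-↔-preserving : {A B S : Set} (P : S → Set) (φ : A ↔ B) {f : A → S} {g : B → S} →
  (∀ a → f a ≡ g (Inverse.to φ a)) → Σ A (P ∘ f) ↔ Σ B (P ∘ g)
Σ-↔-preserving P φ {f} eq = Σ-↔ φ λ {a} → subst (λ z → P (f a) ↔ P z) (eq a) ↔-refl

ShapedTableaux : (ℕ × ℕ → Set) → Shape n → Set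
ShapedTableaux P s = Σ (Tableau s) (P ∘ stats)

addFree : Bool → ℕ × ℕ → ℕ × ℕ
addFree b z = bit b + proj₁ z , bit (not b) + proj₂ z

-- Lines without cells

module EmptyLine {n} (s : Shape (suc n)) (j : Fin (suc n))
  (noRowCells : ∀ q → ¬ IsCell s j q) (noColCells : ∀ p → ¬ IsCell s p j) where

  open Deletion s j
  open Insertion (λ _ _ → empty)
  open ValidFilling

  admissible : Admissible
  admissible = record
    { rowOnCells      = λ _ _ → refl
    ; colOnCells      = λ _ _ → refl
    ; rowLeftRule     = λ _ _ ()
    ; colUpRule       = λ _ _ ()
    ; colNoLeft       = λ _ ()
    ; rowNoUp         = λ _ ()
    ; emptyLeftOfLeft = λ _ _ _ _ _ _ → refl
    ; emptyAboveUp    = λ _ _ _ _ _ _ → refl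
    }

  line-empty : ∀ f → .(ValidFilling s f) → AgreesOnLine f
  line-empty f v p q (inj₁ refl) = recompute (entry f j q ≟ᶜ empty) (onCells v j q (noRowCells q))
  line-empty f v p q (inj₂ refl) = recompute (entry f p j ≟ᶜ empty) (onCells v p j (noColCells p))

  tableau↔ : Tableau s ↔ Tableau s⁻
  tableau↔ = mk↔ₛ′
    (λ { (tableau f v) → tableau (delete f) (delete-valid v) })
    (λ { (tableau f v) → tableau (insert f) (insert-valid admissible v) })
    (λ { (tableau f v) → tableau-≡ (delete-insert f) })
    (λ { (tableau f v) → tableau-≡ (insert-delete f (line-empty f v)) })

  stats-delete : ∀ t → stats t ≡ addFree (isRow s j) (stats (Inverse.to tableau↔ t))
  stats-delete (tableau f v) = cong₂ _,_
    (trans (count-rowFree-delete f (λ p → cong isLeft (line-empty f v p j (inj₂ refl))))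
           (cong (λ b → bit b + count (rowFree s⁻ (delete f)))
                 (lineFree (isRow s j) (λ q → cong isLeft (line-empty f v j q (inj₁ refl))))))
    (trans (count-colFree-delete f (λ q → cong isUp (line-empty f v j q (inj₁ refl))))
           (cong (λ b → bit b + count (colFree s⁻ (delete f)))
                 (lineFree (isCol s j) (λ p → cong isUp (line-empty f v p j (inj₂ refl))))))
    where
    lineFree : ∀ b {P : Fin (suc n) → Bool} → (∀ x → P x ≡ false) → b ∧ not (anyFin P) ≡ b
    lineFree b {P} none = trans (cong (λ a → b ∧ not a) (anyFin-false P none)) (Boolₚ.∧-identityʳ b)

  shapedTableaux↔ : ∀ P → ShapedTableaux P s ↔ ShapedTableaux (P ∘ addFree (isRow s j)) s⁻
  shapedTableaux↔ P = Σ-↔-preserving P tableau↔ stats-delete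

deleteFirstColumn : ∀ P (x : Shape n) → ShapedTableaux P (false ∷ x) ↔ ShapedTableaux (P ∘ addFree false) x
deleteFirstColumn P x =
  EmptyLine.shapedTableaux↔ (false ∷ x) zero (col⇒¬isCell {s = false ∷ x} refl) (λ { p (_ , _ , ()) }) P

deleteLastRow : ∀ P (x : Shape n) → ShapedTableaux P (x ∷ʳ true) ↔ ShapedTableaux (P ∘ addFree true) x
deleteLastRow {n} P x =
  subst₂ (λ b y → ShapedTableaux P (x ∷ʳ true) ↔ ShapedTableaux (P ∘ addFree b) y)
    (lookup-∷ʳ-last x true) (removeAt-∷ʳ x true)
    (EmptyLine.shapedTableaux↔ (x ∷ʳ true) (fromℕ n)
      noRowCells (row⇒¬isCell {s = x ∷ʳ true} (lookup-∷ʳ-last x true)) P)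
  where
  noRowCells : ∀ q → ¬ IsCell (x ∷ʳ true) (fromℕ n) q
  noRowCells q (_ , _ , last<q) = ℕₚ.<⇒≱ last<q (Finₚ.≤fromℕ q)

-- Exchanging adjacent steps

swapFilling : Fin (suc n) → Filling (suc (suc n)) → Filling (suc (suc n))
swapFilling k f = tabulateFilling λ p q → entry f (swapAt k p) (swapAt k q)

entry-swapFilling : ∀ (k : Fin (suc n)) f p q → entry (swapFilling k f) p q ≡ entry f (swapAt k p) (swapAt k q)
entry-swapFilling k f = entry-tabulateFilling _

swapFilling-involutive : ∀ (k : Fin (suc n)) f → swapFilling k (swapFilling k f) ≡ f
swapFilling-involutive k f = filling-ext λ p q → begin
  entry (swapFilling k (swapFilling k f)) p q
    ≡⟨ entry-swapFilling k (swapFilling k f) p q ⟩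
  entry (swapFilling k f) (swapAt k p) (swapAt k q)
    ≡⟨ entry-swapFilling k f _ _ ⟩
  entry f (swapAt k (swapAt k p)) (swapAt k (swapAt k q))
    ≡⟨ cong₂ (entry f) (swapAt-involutive k p) (swapAt-involutive k q) ⟩
  entry f p q ∎
  where open ≡-Reasoning

module Swap {n} (s s′ : Shape (suc (suc n))) (k : Fin (suc n))
  (s′≡ : ∀ p → lookup s′ p ≡ lookup s (swapAt k p)) where

  open ValidFilling

  i₀ i₁ : Fin (suc (suc n))
  i₀ = inject₁ k
  i₁ = suc k

  StepsDiffer : Set
  StepsDiffer = (lookup s i₀ ≡ true × lookup s i₁ ≡ false) ⊎ (lookup s i₀ ≡ false × lookup s i₁ ≡ true)

  -- swapAt k reverses the order of i₀ and i₁ only; as one of them is a row and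
  -- the other a column, the arrow rules across that pair hold trivially.
  swap-valid : ∀ {f} → ValidFilling s f → entry f i₀ i₁ ≡ empty → StepsDiffer →
    ValidFilling s′ (swapFilling k f)
  swap-valid {f} v corner-empty differ = record { onCells = onCells′ ; leftRule = leftRule′ ; upRule = upRule′ }
    where
    σ = swapAt k
    sw = entry-swapFilling k f

    onCells′ : ∀ p q → ¬ IsCell s′ p q → entry (swapFilling k f) p q ≡ empty
    onCells′ p q ¬cell with entry f (σ p) (σ q) ≟ᶜ empty
    ... | yes e = trans (sw p q) e
    ... | no ≢e with nonEmpty⇒isCell v (σ p) (σ q) ≢e
    ...   | row , col , σp<σq with swapAt-mono-< k σp<σq
    ...     | inj₁ p<q = ⊥-elim (¬cell (trans (s′≡ p) row , trans (cong not (s′≡ q)) col ,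
                subst₂ _<_ (swapAt-involutive k p) (swapAt-involutive k q) p<q))
    ...     | inj₂ (σp≡i₀ , σq≡i₁) = ⊥-elim (≢e (subst₂ (λ a b → entry f a b ≡ empty) (sym σp≡i₀) (sym σq≡i₁) corner-empty))

    leftRule′ : ∀ p q q′ → entry (swapFilling k f) p q ≡ left → q < q′ → entry (swapFilling k f) p q′ ≡ empty
    leftRule′ p q q′ e q<q′ with swapAt-mono-< k q<q′
    ... | inj₁ σq<σq′ = trans (sw p q′) (leftRule v _ _ _ (trans (sym (sw p q)) e) σq<σq′)
    ... | inj₂ (refl , refl) =
      trans (sw p q′) (subst (λ a → entry f (σ p) a ≡ empty) (sym (swapAt-suc k)) (emptyAt-i₀ differ))
      where
      left-i₁ : entry f (σ p) i₁ ≡ left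
      left-i₁ = trans (cong (entry f (σ p)) (sym (swapAt-inject₁ k))) (trans (sym (sw p q)) e)
      emptyAt-i₀ : StepsDiffer → entry f (σ p) i₀ ≡ empty
      emptyAt-i₀ (inj₁ (row₀ , _)) = onCells v (σ p) i₀ (row⇒¬isCell {s = s} row₀ (σ p))
      emptyAt-i₀ (inj₂ (_ , row₁)) = ⊥-elim (row⇒¬isCell {s = s} row₁ (σ p)
        (nonEmpty⇒isCell v (σ p) i₁ (left≢empty ∘ trans (sym left-i₁))))

    upRule′ : ∀ p p′ q → entry (swapFilling k f) p q ≡ up → p′ < p → entry (swapFilling k f) p′ q ≡ empty
    upRule′ p p′ q e p′<p with swapAt-mono-< k p′<p
    ... | inj₁ σp′<σp = trans (sw p′ q) (upRule v _ _ _ (trans (sym (sw p q)) e) σp′<σp)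
    ... | inj₂ (refl , refl) =
      trans (sw p′ q) (subst (λ a → entry f a (σ q) ≡ empty) (sym (swapAt-inject₁ k)) (emptyAt-i₁ differ))
      where
      up-i₀ : entry f i₀ (σ q) ≡ up
      up-i₀ = trans (cong (λ a → entry f a (σ q)) (sym (swapAt-suc k))) (trans (sym (sw p q)) e)
      emptyAt-i₁ : StepsDiffer → entry f i₁ (σ q) ≡ empty
      emptyAt-i₁ (inj₁ (_ , col₁)) = onCells v i₁ (σ q) (col⇒¬isCell {s = s} col₁ (σ q))
      emptyAt-i₁ (inj₂ (col₀ , _)) = ⊥-elim (col⇒¬isCell {s = s} col₀ (σ q)
        (nonEmpty⇒isCell v i₀ (σ q) (up≢empty ∘ trans (sym up-i₀))))

  count-rowFree-swap : ∀ f → count (rowFree s′ (swapFilling k f)) ≡ count (rowFree s f)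
  count-rowFree-swap f = trans (count-cong rowFree-σ) (count-swapAt k (rowFree s f))
    where
    rowFree-σ : ∀ p → rowFree s′ (swapFilling k f) p ≡ rowFree s f (swapAt k p)
    rowFree-σ p = cong₂ (λ a b → a ∧ not b) (s′≡ p)
      (trans (anyFin-cong (cong isLeft ∘ entry-swapFilling k f p))
             (anyFin-swapAt k (λ q → isLeft (entry f (swapAt k p) q))))

  count-colFree-swap : ∀ f → count (colFree s′ (swapFilling k f)) ≡ count (colFree s f)
  count-colFree-swap f = trans (count-cong colFree-σ) (count-swapAt k (colFree s f))
    where
    colFree-σ : ∀ q → colFree s′ (swapFilling k f) q ≡ colFree s f (swapAt k q)
    colFree-σ q = cong₂ (λ a b → not a ∧ not b) (s′≡ q)
      (trans (anyFin-cong (λ p → cong isUp (entry-swapFilling k f p q)))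
             (anyFin-swapAt k (λ p → isUp (entry f p (swapAt k q)))))

single : Fin m → Fin m → Content → Fin m → Fin m → Content
single a b c p q with p Fin.≟ a | q Fin.≟ b
... | yes _ | yes _ = c
... | _     | _     = empty

module _ (a b : Fin m) (c : Content) where

  single-self : single a b c a b ≡ c
  single-self with a Fin.≟ a | b Fin.≟ b
  ... | yes _  | yes _  = refl
  ... | yes _  | no b≢b = ⊥-elim (b≢b refl)
  ... | no a≢a | _      = ⊥-elim (a≢a refl)

  single-elsewhere : ∀ {p q} → (p ≡ a → q ≡ b → ⊥) → single a b c p q ≡ empty
  single-elsewhere {p} {q} away with p Fin.≟ a | q Fin.≟ b
  ... | yes p≡a | yes q≡b = ⊥-elim (away p≡a q≡b)
  ... | yes _   | no _    = refl
  ... | no _    | _       = refl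

  single-support : ∀ {p q} → single a b c p q ≢ empty → p ≡ a × q ≡ b
  single-support {p} {q} ≢empty with p Fin.≟ a | q Fin.≟ b
  ... | yes p≡a | yes q≡b = p≡a , q≡b
  ... | yes _   | no _    = ⊥-elim (≢empty refl)
  ... | no _    | _       = ⊥-elim (≢empty refl)

  single-≢ : ∀ {p q c′} → c′ ≢ c → c′ ≢ empty → single a b c p q ≢ c′
  single-≢ {p} {q} c′≢c c′≢empty with p Fin.≟ a | q Fin.≟ b
  ... | yes _ | yes _ = c′≢c ∘ sym
  ... | yes _ | no _  = c′≢empty ∘ sym
  ... | no _  | _     = c′≢empty ∘ sym

  single-false : (P : Content → Bool) → P empty ≡ false → P c ≡ false → ∀ p q → P (single a b c p q) ≡ false
  single-false P Pempty Pc p q with p Fin.≟ a | q Fin.≟ b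
  ... | yes _ | yes _ = Pc
  ... | yes _ | no _  = Pempty
  ... | no _  | _     = Pempty

  single-onCells : ∀ (s : Shape m) → IsCell s a b → ∀ p q → ¬ IsCell s p q → single a b c p q ≡ empty
  single-onCells s cell p q ¬cell = single-elsewhere λ { refl refl → ¬cell cell }

  single-right : ∀ p q q′ → single a b c p q ≢ empty → q < q′ → single a b c p q′ ≡ empty
  single-right p q q′ ≢empty q<q′ = single-elsewhere λ _ q′≡b →
    Finₚ.<⇒≢ q<q′ (trans (proj₂ (single-support ≢empty)) (sym q′≡b))

  single-above : ∀ p p′ q → single a b c p q ≢ empty → p′ < p → single a b c p′ q ≡ empty
  single-above p p′ q ≢empty p′<p = single-elsewhere λ p′≡a _ →
    Finₚ.<⇒≢ p′<p (trans p′≡a (sym (proj₁ (single-support ≢empty))))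

-- Corners

module Corner {n} (s : Shape (suc (suc n))) (k : Fin (suc n))
  (row₀ : lookup s (inject₁ k) ≡ true) (col₁ : lookup s (suc k) ≡ false) where

  open ValidFilling

  i₀ i₁ : Fin (suc (suc n))
  i₀ = inject₁ k
  i₁ = suc k

  i₀≢i₁ : i₀ ≢ i₁
  i₀≢i₁ = Finₚ.<⇒≢ (inject₁<suc k)

  corner : IsCell s i₀ i₁
  corner = row₀ , cong not col₁ , inject₁<suc k

  swapped : Shape (suc (suc n))
  swapped = swapAdjacent s k

  module ColumnDeletion = Deletion s i₁
  module RowDeletion    = Deletion s i₀
  module ColumnInsertion = ColumnDeletion.Insertion (single i₀ i₁ up)
  module RowInsertion    = RowDeletion.Insertion (single i₀ i₁ left)

  up-admissible : ColumnInsertion.Admissible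
  up-admissible = record
    { rowOnCells      = single-onCells i₀ i₁ up s corner i₁
    ; colOnCells      = λ p → single-onCells i₀ i₁ up s corner p i₁
    ; rowLeftRule     = λ q _ e → ⊥-elim (single-≢ i₀ i₁ up left≢up left≢empty e)
    ; colUpRule       = λ p p′ e → single-above i₀ i₁ up p p′ i₁ (up≢empty ∘ trans (sym e))
    ; colNoLeft       = λ x → single-≢ i₀ i₁ up left≢up left≢empty
    ; rowNoUp         = λ y e → i₀≢i₁ (sym (proj₁ (single-support i₀ i₁ up (up≢empty ∘ trans (sym e)))))
    ; emptyLeftOfLeft = emptyLeftOfLeft
    ; emptyAboveUp    = λ _ _ _ _ _ _ → single-elsewhere i₀ i₁ up (λ i₁≡i₀ _ → i₀≢i₁ (sym i₁≡i₀))
    }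
    where
    open ColumnDeletion using (s⁻; π; isCell-punchIn)
    emptyLeftOfLeft : ∀ f → ValidFilling s⁻ f → ∀ x y → entry f x y ≡ left → π y < i₁ →
      single i₀ i₁ up (π x) i₁ ≡ empty
    emptyLeftOfLeft f v x y e πy<i₁ with single i₀ i₁ up (π x) i₁ ≟ᶜ empty
    ... | yes z = z
    ... | no ≢empty with single-support i₀ i₁ up ≢empty
    ...   | πx≡i₀ , _ with isCell-punchIn (nonEmpty⇒isCell v x y (left≢empty ∘ trans (sym e)))
    ...     | _ , _ , πx<πy = ⊥-elim (inject₁<⇒≮suc k (π y) (subst (_< π y) πx≡i₀ πx<πy) πy<i₁)

  left-admissible : RowInsertion.Admissible
  left-admissible = record
    { rowOnCells      = single-onCells i₀ i₁ left s corner i₀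
    ; colOnCells      = λ p → single-onCells i₀ i₁ left s corner p i₀
    ; rowLeftRule     = λ q q′ e → single-right i₀ i₁ left i₀ q q′ (left≢empty ∘ trans (sym e))
    ; colUpRule       = λ p _ e → ⊥-elim (single-≢ i₀ i₁ left (left≢up ∘ sym) up≢empty e)
    ; colNoLeft       = λ x e → i₀≢i₁ (proj₂ (single-support i₀ i₁ left (left≢empty ∘ trans (sym e))))
    ; rowNoUp         = λ y → single-≢ i₀ i₁ left (left≢up ∘ sym) up≢empty
    ; emptyLeftOfLeft = λ _ _ _ _ _ _ → single-elsewhere i₀ i₁ left (λ _ i₀≡i₁ → i₀≢i₁ i₀≡i₁)
    ; emptyAboveUp    = emptyAboveUp
    }
    where
    open RowDeletion using (s⁻; π; isCell-punchIn)
    emptyAboveUp : ∀ f → ValidFilling s⁻ f → ∀ x y → entry f x y ≡ up → i₀ < π x →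
      single i₀ i₁ left i₀ (π y) ≡ empty
    emptyAboveUp f v x y e i₀<πx with single i₀ i₁ left i₀ (π y) ≟ᶜ empty
    ... | yes z = z
    ... | no ≢empty with single-support i₀ i₁ left ≢empty
    ...   | _ , πy≡i₁ with isCell-punchIn (nonEmpty⇒isCell v x y (up≢empty ∘ trans (sym e)))
    ...     | _ , _ , πx<πy = ⊥-elim (inject₁<⇒≮suc k (π x) i₀<πx (subst (π x <_) πy≡i₁ πx<πy))

  up-agrees : ∀ f → .(ValidFilling s f) → entry f i₀ i₁ ≡ up → ColumnInsertion.AgreesOnLine f
  up-agrees f v e p q (inj₁ refl) =
    trans (recompute (entry f i₁ q ≟ᶜ empty) (onCells v i₁ q (col⇒¬isCell {s = s} col₁ q)))
          (sym (single-elsewhere i₀ i₁ up (λ i₁≡i₀ _ → i₀≢i₁ (sym i₁≡i₀))))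
  up-agrees f v e p q (inj₂ refl) with toSum (p Fin.≟ i₀)
  ... | inj₁ refl = trans e (sym (single-self i₀ i₁ up))
  ... | inj₂ p≢i₀ = trans (recompute (entry f p i₁ ≟ᶜ empty) (emptyAbove v p≢i₀))
                          (sym (single-elsewhere i₀ i₁ up (λ p≡i₀ _ → p≢i₀ p≡i₀)))
    where
    emptyAbove : ValidFilling s f → p ≢ i₀ → entry f p i₁ ≡ empty
    emptyAbove v p≢i₀ with entry f p i₁ ≟ᶜ empty
    ... | yes z = z
    ... | no ≢empty with nonEmpty⇒isCell v p i₁ ≢empty
    ...   | _ , _ , p<i₁ = upRule v i₀ p i₁ e (<suc∧≢inject₁⇒<inject₁ k p p<i₁ p≢i₀)

  left-agrees : ∀ f → .(ValidFilling s f) → entry f i₀ i₁ ≡ left → RowInsertion.AgreesOnLine f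
  left-agrees f v e p q (inj₂ refl) =
    trans (recompute (entry f p i₀ ≟ᶜ empty) (onCells v p i₀ (row⇒¬isCell {s = s} row₀ p)))
          (sym (single-elsewhere i₀ i₁ left (λ _ i₀≡i₁ → i₀≢i₁ i₀≡i₁)))
  left-agrees f v e p q (inj₁ refl) with toSum (q Fin.≟ i₁)
  ... | inj₁ refl = trans e (sym (single-self i₀ i₁ left))
  ... | inj₂ q≢i₁ = trans (recompute (entry f i₀ q ≟ᶜ empty) (emptyRight v q≢i₁))
                          (sym (single-elsewhere i₀ i₁ left (λ _ q≡i₁ → q≢i₁ q≡i₁)))
    where
    emptyRight : ValidFilling s f → q ≢ i₁ → entry f i₀ q ≡ empty
    emptyRight v q≢i₁ with entry f i₀ q ≟ᶜ empty
    ... | yes z = z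
    ... | no ≢empty with nonEmpty⇒isCell v i₀ q ≢empty
    ...   | _ , _ , i₀<q = leftRule v i₀ i₁ q e (inject₁<∧≢suc⇒suc< k q i₀<q q≢i₁)

  Split : Set
  Split = Tableau swapped ⊎ (Tableau (removeAt s i₁) ⊎ Tableau (removeAt s i₀))

  module ToSwapped   = Swap s swapped k (lookup-swapAdjacent s k)
  module FromSwapped = Swap swapped s k (λ p →
    trans (cong (lookup s) (sym (swapAt-involutive k p))) (sym (lookup-swapAdjacent s k (swapAt k p))))

  swapped-col₀ : lookup swapped i₀ ≡ false
  swapped-col₀ = trans (lookup-swapAdjacent s k i₀) (trans (cong (lookup s) (swapAt-inject₁ k)) col₁)

  swapped-row₁ : lookup swapped i₁ ≡ true
  swapped-row₁ = trans (lookup-swapAdjacent s k i₁) (trans (cong (lookup s) (swapAt-suc k)) row₀)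

  splitBy : ∀ f → .(ValidFilling s f) → ∀ c → entry f i₀ i₁ ≡ c → Split
  splitBy f v empty e = inj₁ (tableau (swapFilling k f) (ToSwapped.swap-valid v e (inj₁ (row₀ , col₁))))
  splitBy f v up    e = inj₂ (inj₁ (tableau (ColumnDeletion.delete f) (ColumnDeletion.delete-valid v)))
  splitBy f v left  e = inj₂ (inj₂ (tableau (RowDeletion.delete f) (RowDeletion.delete-valid v)))

  split : Tableau s → Split
  split (tableau f v) = splitBy f v (entry f i₀ i₁) refl

  unsplit : Split → Tableau s
  unsplit (inj₁ (tableau f v)) = tableau (swapFilling k f)
    (FromSwapped.swap-valid v (onCells v i₀ i₁ (col⇒¬isCell {s = swapped} swapped-col₀ i₁))
                              (inj₂ (swapped-col₀ , swapped-row₁)))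
  unsplit (inj₂ (inj₁ (tableau f v))) =
    tableau (ColumnInsertion.insert f) (ColumnInsertion.insert-valid up-admissible v)
  unsplit (inj₂ (inj₂ (tableau f v))) =
    tableau (RowInsertion.insert f) (RowInsertion.insert-valid left-admissible v)

  unsplit-splitBy : ∀ f .(v : ValidFilling s f) c (e : entry f i₀ i₁ ≡ c) →
    unsplit (splitBy f v c e) ≡ tableau f v
  unsplit-splitBy f v empty e = tableau-≡ (swapFilling-involutive k f)
  unsplit-splitBy f v up    e = tableau-≡ (ColumnInsertion.insert-delete f (up-agrees f v e))
  unsplit-splitBy f v left  e = tableau-≡ (RowInsertion.insert-delete f (left-agrees f v e))

  swapped-corner-empty : ∀ f → .(ValidFilling swapped f) → entry (swapFilling k f) i₀ i₁ ≡ empty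
  swapped-corner-empty f v = trans (entry-swapFilling k f i₀ i₁)
    (subst₂ (λ a b → entry f a b ≡ empty) (sym (swapAt-inject₁ k)) (sym (swapAt-suc k))
      (recompute (entry f i₁ i₀ ≟ᶜ empty)
        (ValidFilling.onCells v i₁ i₀ λ (_ , _ , i₁<i₀) → Finₚ.<-asym i₁<i₀ (inject₁<suc k))))

  splitBy-unsplit : ∀ y .w c (e : entry (Tableau.filling (unsplit y)) i₀ i₁ ≡ c) →
    splitBy (Tableau.filling (unsplit y)) w c e ≡ y
  splitBy-unsplit (inj₁ (tableau f v)) w empty e = cong inj₁ (tableau-≡ (swapFilling-involutive k f))
  splitBy-unsplit (inj₁ (tableau f v)) w up    e =
    ⊥-elim (up≢empty (trans (sym e) (swapped-corner-empty f v)))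
  splitBy-unsplit (inj₁ (tableau f v)) w left  e =
    ⊥-elim (left≢empty (trans (sym e) (swapped-corner-empty f v)))
  splitBy-unsplit (inj₂ (inj₁ (tableau f v))) w c e
    with trans (sym e) (trans (ColumnInsertion.entry-insert-col f i₀) (single-self i₀ i₁ up))
  ... | refl = cong (inj₂ ∘ inj₁) (tableau-≡ (ColumnInsertion.delete-insert f))
  splitBy-unsplit (inj₂ (inj₂ (tableau f v))) w c e
    with trans (sym e) (trans (RowInsertion.entry-insert-row f i₁) (single-self i₀ i₁ left))
  ... | refl = cong (inj₂ ∘ inj₂) (tableau-≡ (RowInsertion.delete-insert f))

  tableau↔ : Tableau s ↔ Split
  tableau↔ = mk↔ₛ′ split unsplit
    (λ y → splitBy-unsplit y _ _ refl)
    (λ { (tableau f v) → unsplit-splitBy f v _ refl })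

  statsOfSplit : Split → ℕ × ℕ
  statsOfSplit (inj₁ t)        = stats t
  statsOfSplit (inj₂ (inj₁ t)) = stats t
  statsOfSplit (inj₂ (inj₂ t)) = stats t

  stats-deleteColumn : ∀ f .(v : ValidFilling s f) → entry f i₀ i₁ ≡ up →
    stats (tableau {s = s} f v) ≡
    stats (tableau {s = removeAt s i₁} (ColumnDeletion.delete f) (ColumnDeletion.delete-valid v))
  stats-deleteColumn f v e = cong₂ _,_
    (trans (count-rowFree-delete f noLeftInColumn)
           (cong (λ b → bit (b ∧ not (anyFin λ q → isLeft (entry f i₁ q))) + count (rowFree s⁻ (delete f)))
                 col₁))
    (trans (count-colFree-delete f noUpInRow)
           (cong (λ b → bit b + count (colFree s⁻ (delete f))) columnNotFree))
    where
    open ColumnDeletion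
    agrees = up-agrees f v e
    noLeftInColumn : ∀ p → isLeft (entry f p i₁) ≡ false
    noLeftInColumn p =
      trans (cong isLeft (agrees p i₁ (inj₂ refl))) (single-false i₀ i₁ up isLeft refl refl p i₁)
    noUpInRow : ∀ q → isUp (entry f i₁ q) ≡ false
    noUpInRow q = cong isUp (trans (agrees i₁ q (inj₁ refl))
                                   (single-elsewhere i₀ i₁ up (λ i₁≡i₀ _ → i₀≢i₁ (sym i₁≡i₀))))
    columnNotFree : colFree s f i₁ ≡ false
    columnNotFree =
      trans (cong (λ b → isCol s i₁ ∧ not b) (anyFin-true (λ p → isUp (entry f p i₁)) i₀ (cong isUp e)))
            (Boolₚ.∧-zeroʳ (isCol s i₁))

  stats-deleteRow : ∀ f .(v : ValidFilling s f) → entry f i₀ i₁ ≡ left →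
    stats (tableau {s = s} f v) ≡
    stats (tableau {s = removeAt s i₀} (RowDeletion.delete f) (RowDeletion.delete-valid v))
  stats-deleteRow f v e = cong₂ _,_
    (trans (count-rowFree-delete f noLeftInColumn)
           (cong (λ b → bit b + count (rowFree s⁻ (delete f))) rowNotFree))
    (trans (count-colFree-delete f noUpInRow)
           (cong (λ b → bit (not b ∧ not (anyFin λ p → isUp (entry f p i₀))) + count (colFree s⁻ (delete f)))
                 row₀))
    where
    open RowDeletion
    agrees = left-agrees f v e
    noLeftInColumn : ∀ p → isLeft (entry f p i₀) ≡ false
    noLeftInColumn p = cong isLeft (trans (agrees p i₀ (inj₂ refl))
                                          (single-elsewhere i₀ i₁ left (λ _ i₀≡i₁ → i₀≢i₁ i₀≡i₁)))
    noUpInRow : ∀ q → isUp (entry f i₀ q) ≡ false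
    noUpInRow q = trans (cong isUp (agrees i₀ q (inj₁ refl))) (single-false i₀ i₁ left isUp refl refl i₀ q)
    rowNotFree : rowFree s f i₀ ≡ false
    rowNotFree =
      trans (cong (λ b → isRow s i₀ ∧ not b) (anyFin-true (λ q → isLeft (entry f i₀ q)) i₁ (cong isLeft e)))
            (Boolₚ.∧-zeroʳ (isRow s i₀))

  stats-splitBy : ∀ f .(v : ValidFilling s f) c (e : entry f i₀ i₁ ≡ c) →
    stats (tableau {s = s} f v) ≡ statsOfSplit (splitBy f v c e)
  stats-splitBy f v empty e =
    sym (cong₂ _,_ (ToSwapped.count-rowFree-swap f) (ToSwapped.count-colFree-swap f))
  stats-splitBy f v up    e = stats-deleteColumn f v e
  stats-splitBy f v left  e = stats-deleteRow f v e

  shapedTableaux↔ : ∀ P → ShapedTableaux P s ↔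
    (ShapedTableaux P swapped ⊎ (ShapedTableaux P (removeAt s i₁) ⊎ ShapedTableaux P (removeAt s i₀)))
  shapedTableaux↔ P =
    ↔-trans (Σ-↔-preserving P tableau↔ {g = statsOfSplit}
               λ { (tableau f v) → stats-splitBy f v _ refl })
            (↔-trans Σ-distribʳ-⊎ (⊎-cong ↔-refl (Σ-distribʳ-⊎ {P = P ∘ statsOfSplit ∘ inj₂})))

Σ-Vec-head↔ : ∀ (B : Vec Bool (suc m) → Set) →
  Σ (Vec Bool (suc m)) B ↔ (Σ (Vec Bool m) (B ∘ (true ∷_)) ⊎ Σ (Vec Bool m) (B ∘ (false ∷_)))
Σ-Vec-head↔ B = mk↔ₛ′
  (λ { (true ∷ x , b) → inj₁ (x , b) ; (false ∷ x , b) → inj₂ (x , b) })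
  (λ { (inj₁ (x , b)) → true ∷ x , b ; (inj₂ (x , b)) → false ∷ x , b })
  (λ { (inj₁ _) → refl ; (inj₂ _) → refl })
  (λ { (true ∷ x , b) → refl ; (false ∷ x , b) → refl })

Σ-Vec-last↔ : ∀ m (B : Vec Bool (suc m) → Set) →
  Σ (Vec Bool (suc m)) B ↔ Σ (Vec Bool m) (λ x → B (x ∷ʳ true) ⊎ B (x ∷ʳ false))
Σ-Vec-last↔ zero B = mk↔ₛ′
  (λ { (true ∷ [] , b) → [] , inj₁ b ; (false ∷ [] , b) → [] , inj₂ b })
  (λ { ([] , inj₁ b) → true ∷ [] , b ; ([] , inj₂ b) → false ∷ [] , b })
  (λ { ([] , inj₁ _) → refl ; ([] , inj₂ _) → refl })
  (λ { (true ∷ [] , b) → refl ; (false ∷ [] , b) → refl })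
Σ-Vec-last↔ (suc m) B =
  ↔-trans (Σ-Vec-head↔ B)
  (↔-trans (⊎-cong (Σ-Vec-last↔ m (B ∘ (true ∷_))) (Σ-Vec-last↔ m (B ∘ (false ∷_))))
           (↔-sym (Σ-Vec-head↔ λ x → B (x ∷ʳ true) ⊎ B (x ∷ʳ false))))

-- Stated for an arbitrary family so that bubbleLastColumn can recurse on B ∘ (a ∷_).
CornerSplitting : (∀ {n} → Shape n → Set) → Set
CornerSplitting B = ∀ {n} (s : Shape (suc (suc n))) (k : Fin (suc n)) →
  lookup s (inject₁ k) ≡ true → lookup s (suc k) ≡ false →
  B s ↔ (B (swapAdjacent s k) ⊎ (B (removeAt s (suc k)) ⊎ B (removeAt s (inject₁ k))))

cornerSplitting-∷ : ∀ {B : ∀ {n} → Shape n → Set} → CornerSplitting B → ∀ a → CornerSplitting (B ∘ (a ∷_))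
cornerSplitting-∷ split a (b ∷ c ∷ s) k = split (a ∷ b ∷ c ∷ s) (suc k)

⊎-rearrange : ∀ {A B C D E F : Set} →
  (((A ⊎ (C ⊎ D)) ⊎ E) ⊎ (B ⊎ F)) ↔ ((A ⊎ B) ⊎ ((C ⊎ D) ⊎ (E ⊎ F)))
⊎-rearrange = mk↔ₛ′
  (λ { (inj₁ (inj₁ (inj₁ a)))  → inj₁ (inj₁ a)
     ; (inj₁ (inj₁ (inj₂ cd))) → inj₂ (inj₁ cd)
     ; (inj₁ (inj₂ e))         → inj₂ (inj₂ (inj₁ e))
     ; (inj₂ (inj₁ b))         → inj₁ (inj₂ b)
     ; (inj₂ (inj₂ f))         → inj₂ (inj₂ (inj₂ f)) })
  (λ { (inj₁ (inj₁ a))         → inj₁ (inj₁ (inj₁ a))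
     ; (inj₂ (inj₁ cd))        → inj₁ (inj₁ (inj₂ cd))
     ; (inj₂ (inj₂ (inj₁ e)))  → inj₁ (inj₂ e)
     ; (inj₁ (inj₂ b))         → inj₂ (inj₁ b)
     ; (inj₂ (inj₂ (inj₂ f)))  → inj₂ (inj₂ f) })
  (λ { (inj₁ (inj₁ _)) → refl ; (inj₂ (inj₁ _)) → refl ; (inj₂ (inj₂ (inj₁ _))) → refl
     ; (inj₁ (inj₂ _)) → refl ; (inj₂ (inj₂ (inj₂ _))) → refl })
  (λ { (inj₁ (inj₁ (inj₁ _))) → refl ; (inj₁ (inj₁ (inj₂ _))) → refl ; (inj₁ (inj₂ _)) → refl
     ; (inj₂ (inj₁ _)) → refl ; (inj₂ (inj₂ _)) → refl })

Fin-suc×↔ : ∀ {X : Set} → (Fin (suc m) × X) ↔ (X ⊎ (Fin m × X))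
Fin-suc×↔ = mk↔ₛ′
  (λ { (zero , x) → inj₁ x ; (suc i , x) → inj₂ (i , x) })
  (λ { (inj₁ x) → zero , x ; (inj₂ (i , x)) → suc i , x })
  (λ { (inj₁ _) → refl ; (inj₂ _) → refl })
  (λ { (zero , _) → refl ; (suc _ , _) → refl })

bubbleLastColumn : ∀ m (B : ∀ {n} → Shape n → Set) → CornerSplitting B →
  Σ (Shape m) (λ x → B (x ∷ʳ false)) ↔ (Σ (Shape m) (B ∘ (false ∷_)) ⊎ (Fin m × Σ (Shape m) B))
bubbleLastColumn zero B split = mk↔ₛ′
  (λ { ([] , b) → inj₁ ([] , b) })
  (λ { (inj₁ ([] , b)) → [] , b })
  (λ { (inj₁ ([] , b)) → refl })
  (λ { ([] , b) → refl })
bubbleLastColumn (suc m) B split = begin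
  Σ (Shape (suc m)) (λ x → B (x ∷ʳ false))
    ↔⟨ Σ-Vec-head↔ _ ⟩
  (Σ (Shape m) (λ x → B (true ∷ (x ∷ʳ false))) ⊎ Σ (Shape m) (λ x → B (false ∷ (x ∷ʳ false))))
    ↔⟨ ⊎-cong (bubbleLastColumn m (B ∘ (true ∷_)) (cornerSplitting-∷ {B} split true))
              (bubbleLastColumn m (B ∘ (false ∷_)) (cornerSplitting-∷ {B} split false)) ⟩
  ((Σ (Shape m) (λ x → B (true ∷ false ∷ x)) ⊎ (Fin m × Σ (Shape m) (B ∘ (true ∷_)))) ⊎
   (Σ (Shape m) (λ x → B (false ∷ false ∷ x)) ⊎ (Fin m × Σ (Shape m) (B ∘ (false ∷_)))))
    ↔⟨ ⊎-cong (⊎-cong (↔-trans (Σ-↔ ↔-refl (split (true ∷ false ∷ _) zero refl refl))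
                                (↔-trans Σ-distribˡ-⊎ (⊎-cong ↔-refl Σ-distribˡ-⊎))) ↔-refl) ↔-refl ⟩
  (((Σ (Shape m) (λ x → B (false ∷ true ∷ x)) ⊎
     (Σ (Shape m) (B ∘ (true ∷_)) ⊎ Σ (Shape m) (B ∘ (false ∷_)))) ⊎ (Fin m × Σ (Shape m) (B ∘ (true ∷_)))) ⊎
   (Σ (Shape m) (λ x → B (false ∷ false ∷ x)) ⊎ (Fin m × Σ (Shape m) (B ∘ (false ∷_)))))
    ↔⟨ ⊎-rearrange ⟩
  ((Σ (Shape m) (λ x → B (false ∷ true ∷ x)) ⊎ Σ (Shape m) (λ x → B (false ∷ false ∷ x))) ⊎
   ((Σ (Shape m) (B ∘ (true ∷_)) ⊎ Σ (Shape m) (B ∘ (false ∷_))) ⊎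
    ((Fin m × Σ (Shape m) (B ∘ (true ∷_))) ⊎ (Fin m × Σ (Shape m) (B ∘ (false ∷_))))))
    ↔⟨ ↔-sym (⊎-cong (Σ-Vec-head↔ _) (↔-trans Fin-suc×↔ (⊎-cong (Σ-Vec-head↔ B)
                 (↔-trans (×-cong ↔-refl (Σ-Vec-head↔ B)) ×-distribˡ-⊎)))) ⟩
  (Σ (Shape (suc m)) (B ∘ (false ∷_)) ⊎ (Fin (suc m) × Σ (Shape (suc m)) B)) ∎
  where open EquationalReasoning

-- The recurrence and the counts

Tableaux : (ℕ × ℕ → Set) → ℕ → Set
Tableaux P n = Σ (AltTableau n) λ t → P (freeRows t , freeCols t)

Tableaux↔Σshape : ∀ P n → Tableaux P n ↔ Σ (Shape n) (ShapedTableaux P)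
Tableaux↔Σshape P n =
  ↔-trans (Σ-↔-preserving P altTableau↔ freeRows,freeCols≡freeCounts) Σ-assoc
  where
  altTableau↔ : AltTableau n ↔ Σ (Shape n) Tableau
  altTableau↔ = mk↔ₛ′
    (λ { (mkAT s f v) → s , tableau f v }) (λ { (s , tableau f v) → mkAT s f v })
    (λ _ → refl) (λ _ → refl)

tableaux-zero : ∀ P → Tableaux P 0 ↔ P (0 , 0)
tableaux-zero P = ↔-trans (Tableaux↔Σshape P 0) (mk↔ₛ′
  (λ { ([] , tableau [] _ , p) → p })
  (λ p → [] , tableau [] (record { onCells = λ () ; leftRule = λ () ; upRule = λ () }) , p)
  (λ _ → refl)
  (λ { ([] , tableau [] _ , p) → refl }))

tableaux-suc : ∀ P n → Tableaux P (suc n) ↔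
  (Tableaux (P ∘ addFree true) n ⊎ (Tableaux (P ∘ addFree false) n ⊎ (Fin n × Tableaux P n)))
tableaux-suc P n = begin
  Tableaux P (suc n)
    ↔⟨ Tableaux↔Σshape P (suc n) ⟩
  Σ (Shape (suc n)) (ShapedTableaux P)
    ↔⟨ Σ-Vec-last↔ n (ShapedTableaux P) ⟩
  Σ (Shape n) (λ x → ShapedTableaux P (x ∷ʳ true) ⊎ ShapedTableaux P (x ∷ʳ false))
    ↔⟨ Σ-distribˡ-⊎ ⟩
  (Σ (Shape n) (λ x → ShapedTableaux P (x ∷ʳ true)) ⊎ Σ (Shape n) (λ x → ShapedTableaux P (x ∷ʳ false)))
    ↔⟨ ⊎-cong (Σ-↔ ↔-refl (deleteLastRow P _))
              (bubbleLastColumn n (ShapedTableaux P)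
                 (λ s k row col → Corner.shapedTableaux↔ s k row col P)) ⟩
  (Σ (Shape n) (ShapedTableaux (P ∘ addFree true)) ⊎
   (Σ (Shape n) (λ x → ShapedTableaux P (false ∷ x)) ⊎ (Fin n × Σ (Shape n) (ShapedTableaux P))))
    ↔⟨ ⊎-cong ↔-refl (⊎-cong (Σ-↔ ↔-refl (deleteFirstColumn P _)) ↔-refl) ⟩
  (Σ (Shape n) (ShapedTableaux (P ∘ addFree true)) ⊎
   (Σ (Shape n) (ShapedTableaux (P ∘ addFree false)) ⊎ (Fin n × Σ (Shape n) (ShapedTableaux P))))
    ↔⟨ ↔-sym (⊎-cong (Tableaux↔Σshape (P ∘ addFree true) n)
                     (⊎-cong (Tableaux↔Σshape (P ∘ addFree false) n) (×-cong ↔-refl (Tableaux↔Σshape P n)))) ⟩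
  (Tableaux (P ∘ addFree true) n ⊎ (Tableaux (P ∘ addFree false) n ⊎ (Fin n × Tableaux P n))) ∎
  where open EquationalReasoning

tableaux-suc↔Fin : ∀ P n {a b c} →
  Tableaux (P ∘ addFree true) n ↔ Fin a → Tableaux (P ∘ addFree false) n ↔ Fin b → Tableaux P n ↔ Fin c →
  Tableaux P (suc n) ↔ Fin (a + (b + n * c))
tableaux-suc↔Fin P n {a} {b} countRow countCol countRest =
  ↔-trans (tableaux-suc P n)
  (↔-trans (⊎-cong countRow (⊎-cong countCol (×-cong ↔-refl countRest)))
           (↔-sym (↔-trans (Finₚ.+↔⊎ {a}) (⊎-cong ↔-refl (↔-trans (Finₚ.+↔⊎ {b}) (⊎-cong ↔-refl Finₚ.*↔×))))))

uninhabited↔Fin0 : ∀ {A : Set} → ¬ A → A ↔ Fin 0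
uninhabited↔Fin0 ¬a = mk↔ₛ′ (⊥-elim ∘ ¬a) (λ ()) (λ ()) (⊥-elim ∘ ¬a)

contractible↔Fin1 : ∀ {A : Set} (a : A) → (∀ a′ → a ≡ a′) → A ↔ Fin 1
contractible↔Fin1 a centre = mk↔ₛ′ (λ _ → zero) (λ _ → a) (λ { zero → refl }) centre

tableaux-suc-empty : ∀ P n → ¬ Tableaux (P ∘ addFree true) n → ¬ Tableaux (P ∘ addFree false) n →
  ¬ (Fin n × Tableaux P n) → ¬ Tableaux P (suc n)
tableaux-suc-empty P n ¬row ¬col ¬rest = [ ¬row , [ ¬col , ¬rest ] ] ∘ Inverse.to (tableaux-suc P n)

hasFreeLine : ∀ {P} → (∀ z → P z → z ≡ (0 , 0)) → ∀ n → ¬ Tableaux P (suc n)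
hasFreeLine {P} forced n = tableaux-suc-empty P n
  (λ (_ , p) → ℕₚ.1+n≢0 (cong proj₁ (forced _ p)))
  (λ (_ , p) → ℕₚ.1+n≢0 (cong proj₂ (forced _ p)))
  (smaller n)
  where
  smaller : ∀ n → ¬ (Fin n × Tableaux P n)
  smaller (suc n) (_ , t) = hasFreeLine forced n t

tableaux-all↔ : ∀ n → Tableaux (λ _ → ⊤) n ↔ Fin (suc n !)
tableaux-all↔ zero    = ↔-trans (tableaux-zero (λ _ → ⊤)) (contractible↔Fin1 _ λ _ → refl)
tableaux-all↔ (suc n) = tableaux-suc↔Fin (λ _ → ⊤) n (tableaux-all↔ n) (tableaux-all↔ n) (tableaux-all↔ n)

NoFreeRow : ℕ × ℕ → Set
NoFreeRow z = proj₁ z ≡ 0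

tableaux-noFreeRow↔ : ∀ n → Tableaux NoFreeRow n ↔ Fin (n !)
tableaux-noFreeRow↔ zero    = ↔-trans (tableaux-zero NoFreeRow) (contractible↔Fin1 refl (ℕₚ.≡-irrelevant refl))
tableaux-noFreeRow↔ (suc n) =
  tableaux-suc↔Fin NoFreeRow n (uninhabited↔Fin0 λ ()) (tableaux-noFreeRow↔ n) (tableaux-noFreeRow↔ n)

NoFreeRowOneFreeCol : ℕ × ℕ → Set
NoFreeRowOneFreeCol z = proj₁ z ≡ 0 × proj₂ z ≡ 1

tableaux-noFreeRowOneFreeCol-zero↔ : Tableaux NoFreeRowOneFreeCol 0 ↔ Fin 0
tableaux-noFreeRowOneFreeCol-zero↔ = ↔-trans (tableaux-zero NoFreeRowOneFreeCol) (uninhabited↔Fin0 λ ())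

tableaux-noFreeRowOneFreeCol↔ : ∀ n → Tableaux NoFreeRowOneFreeCol (suc n) ↔ Fin (n !)
tableaux-noFreeRowOneFreeCol↔ zero = tableaux-suc↔Fin NoFreeRowOneFreeCol 0
  (uninhabited↔Fin0 λ ())
  (↔-trans (tableaux-zero (NoFreeRowOneFreeCol ∘ addFree false))
           (contractible↔Fin1 (refl , refl) λ (p , q) →
             cong₂ _,_ (ℕₚ.≡-irrelevant refl p) (ℕₚ.≡-irrelevant refl q)))
  tableaux-noFreeRowOneFreeCol-zero↔
tableaux-noFreeRowOneFreeCol↔ (suc n) = tableaux-suc↔Fin NoFreeRowOneFreeCol (suc n)
  (uninhabited↔Fin0 λ ())
  (uninhabited↔Fin0
    (hasFreeLine {NoFreeRowOneFreeCol ∘ addFree false} (λ { _ (refl , refl) → refl }) n))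
  (tableaux-noFreeRowOneFreeCol↔ n)

proposition3p1 : ((n : ℕ) → AltTableau n ↔ Fin (suc n !))
    × ((n : ℕ) → A0* n ↔ Fin (n !))
    × (A01 zero ↔ Fin zero)
    × ((n : ℕ) → A01 (suc n) ↔ Fin (n !))
proposition3p1 =
  (λ n → ↔-trans (↔-sym (×-identityʳ _ (AltTableau n))) (tableaux-all↔ n)) ,
  tableaux-noFreeRow↔ ,
  tableaux-noFreeRowOneFreeCol-zero↔ ,
  tableaux-noFreeRowOneFreeCol↔
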